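{- Let $V$ be a vector space over a field and let $S,T:V\to V$ be surjective linear operators with $ST=TS$. Then the following are equivalent: (i) for any $v,w\in V$ with $Sv=Tw$, there exists $u\in V$ such that $Su=w$ and $Tu=v$; (ii) the restriction $S:\ker T\to\ker T$ is surjective. -}

module Defs where

open import Level using (Level; _⊔_; suc)
open import Data.Product using (Σ; ∃; _×_)
open import Relation.Nullary using (¬_)
open import Algebra.Bundles using (CommutativeRing)
open import Algebra.Module.Bundles using (Module)
open import Algebra.Module.Morphism.Structures using (module ModuleMorphisms)
open import Function.Definitions using (Surjective)

record IsField {c ℓ : Level} (R : CommutativeRing c ℓ) : Set (c ⊔ ℓ) where
  open CommutativeRing R
  field
    1≉0     : ¬ (1# ≈ 0#)
    inverse : ∀ x → ¬ (x ≈ 0#) → Σ Carrier (λ y → (x * y) ≈ 1#)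

record Field (c ℓ : Level) : Set (suc (c ⊔ ℓ)) where
  field
    commutativeRing : CommutativeRing c ℓ
    isField         : IsField commutativeRing
  open CommutativeRing commutativeRing public
  open IsField isField public

VectorSpace : {c ℓ : Level} → Field c ℓ → (m ℓm : Level) → Set (c ⊔ ℓ ⊔ suc (m ⊔ ℓm))
VectorSpace K m ℓm = Module (Field.commutativeRing K) m ℓm

IsLinear : {c ℓ m ℓm : Level} {K : Field c ℓ} (V : VectorSpace K m ℓm) →
           (Module.Carrierᴹ V → Module.Carrierᴹ V) → Set (c ⊔ m ⊔ ℓm)
IsLinear V f = ModuleMorphisms.IsModuleHomomorphism (Module.rawModule V) (Module.rawModule V) f

IsSurjective : {c ℓ m ℓm : Level} {K : Field c ℓ} (V : VectorSpace K m ℓm) →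
               (Module.Carrierᴹ V → Module.Carrierᴹ V) → Set (m ⊔ ℓm)
IsSurjective V f = Surjective (Module._≈ᴹ_ V) (Module._≈ᴹ_ V) f

{-# OPTIONS --safe #-}
module Submission where

open import Defs
open import Level using (Level; _⊔_)
open import Data.Product using (Σ; _×_; _,_)
open import Function.Bundles using (_⇔_; mk⇔)
open import Function.Definitions using (Surjective)
open import Algebra.Bundles using (Group)
open import Algebra.Module.Bundles using (Module)
open import Algebra.Morphism.Structures using (module GroupMorphisms)
open import Algebra.Module.Morphism.Structures using (module ModuleMorphisms)
import Algebra.Properties.Group as GroupProperties
import Relation.Binary.Reasoning.Setoid as SetoidReasoning

module _ {a ℓ} (G : Group a ℓ) where
  open Group G
  open GroupMorphisms rawGroup rawGroup
  open GroupProperties G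
  open SetoidReasoning setoid

  \\-homo : ∀ {h} → IsGroupHomomorphism h → ∀ x y → h (x \\ y) ≈ h x \\ h y
  \\-homo h-homo x y = trans (homo (x ⁻¹) y) (∙-congʳ (⁻¹-homo x))
    where open IsGroupHomomorphism h-homo

  -- The proof works for commuting endomorphisms of any (not necessarily
  -- abelian) group: neither scalars nor surjectivity of S play a role.
  module CommutingEndomorphisms
    {S T : Carrier → Carrier} (S-homo : IsGroupHomomorphism S) (T-homo : IsGroupHomomorphism T)
    where

    private
      module S = IsGroupHomomorphism S-homo
      module T = IsGroupHomomorphism T-homo

    SurjectiveOntoPullback : Set (a ⊔ ℓ)
    SurjectiveOntoPullback = ∀ v w → S v ≈ T w → Σ Carrier λ u → (S u ≈ w) × (T u ≈ v)

    SurjectiveOnKernel : Set (a ⊔ ℓ)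
    SurjectiveOnKernel = ∀ w → T w ≈ ε → Σ Carrier λ u → (T u ≈ ε) × (S u ≈ w)

    surjectiveOntoPullback⇒surjectiveOnKernel : SurjectiveOntoPullback → SurjectiveOnKernel
    surjectiveOntoPullback⇒surjectiveOnKernel lift w Tw≈ε
      with lift ε w (trans S.ε-homo (sym Tw≈ε))
    ... | u , Su≈w , Tu≈ε = u , Tu≈ε , Su≈w

    kernel-correction : (∀ x → S (T x) ≈ T (S x)) →
      ∀ {x v w} → T x ≈ v → S v ≈ T w → T (S x \\ w) ≈ ε
    kernel-correction S∘T≈T∘S {x} {v} {w} Tx≈v Sv≈Tw = begin
      T (S x \\ w)    ≈⟨ \\-homo T-homo (S x) w ⟩
      T (S x) \\ T w  ≈⟨ \\-cong₂ (sym (S∘T≈T∘S x)) (sym Sv≈Tw) ⟩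
      S (T x) \\ S v  ≈⟨ \\-cong₂ (S.⟦⟧-cong Tx≈v) refl ⟩
      S v \\ S v      ≈⟨ inverseˡ (S v) ⟩
      ε               ∎

    corrected-solution : ∀ {x k v w} → T x ≈ v → T k ≈ ε → S k ≈ S x \\ w →
      (S (x ∙ k) ≈ w) × (T (x ∙ k) ≈ v)
    corrected-solution {x} {k} {v} {w} Tx≈v Tk≈ε Sk≈Sx\\w = S[xk]≈w , T[xk]≈v
      where
      S[xk]≈w : S (x ∙ k) ≈ w
      S[xk]≈w = begin
        S (x ∙ k)           ≈⟨ S.homo x k ⟩
        S x ∙ S k           ≈⟨ ∙-congˡ Sk≈Sx\\w ⟩
        S x ∙ (S x \\ w)    ≈⟨ \\-leftDividesˡ (S x) w ⟩
        w                   ∎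
      T[xk]≈v : T (x ∙ k) ≈ v
      T[xk]≈v = begin
        T (x ∙ k)   ≈⟨ T.homo x k ⟩
        T x ∙ T k   ≈⟨ ∙-cong Tx≈v Tk≈ε ⟩
        v ∙ ε       ≈⟨ identityʳ v ⟩
        v           ∎

    -- Given Sv ≈ Tw, pick x with Tx ≈ v; then (Sx)⁻¹w lies in ker T, and
    -- multiplying x by a preimage of it in ker T solves both equations.
    surjectiveOnKernel⇒surjectiveOntoPullback :
      Surjective _≈_ _≈_ T → (∀ x → S (T x) ≈ T (S x)) →
      SurjectiveOnKernel → SurjectiveOntoPullback
    surjectiveOnKernel⇒surjectiveOntoPullback T-surj S∘T≈T∘S onKernel v w Sv≈Tw =
      let (x , x↦v) = T-surj v
          Tx≈v = x↦v refl
          (k , Tk≈ε , Sk≈Sx\\w) = onKernel (S x \\ w) (kernel-correction S∘T≈T∘S Tx≈v Sv≈Tw)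
      in x ∙ k , corrected-solution Tx≈v Tk≈ε Sk≈Sx\\w

proposition5p3 : {c ℓ m ℓm : Level} (K : Field c ℓ) (V : VectorSpace K m ℓm) →
    let open Module V in
    (S T : Carrierᴹ → Carrierᴹ) →
    IsLinear {K = K} V S → IsLinear {K = K} V T →
    IsSurjective {K = K} V S → IsSurjective {K = K} V T →
    (∀ x → S (T x) ≈ᴹ T (S x)) →
    ((∀ v w → S v ≈ᴹ T w → Σ Carrierᴹ (λ u → (S u ≈ᴹ w) × (T u ≈ᴹ v)))
      ⇔
     (∀ w → T w ≈ᴹ 0ᴹ → Σ Carrierᴹ (λ u → (T u ≈ᴹ 0ᴹ) × (S u ≈ᴹ w))))
proposition5p3 K V S T S-linear T-linear _ T-surj S∘T≈T∘S =
  mk⇔ surjectiveOntoPullback⇒surjectiveOnKernel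
      (surjectiveOnKernel⇒surjectiveOntoPullback T-surj S∘T≈T∘S)
  where
  open Module V using (+ᴹ-group; rawModule)
  open ModuleMorphisms rawModule rawModule using (module IsModuleHomomorphism)
  open CommutingEndomorphisms +ᴹ-group
    (IsModuleHomomorphism.+ᴹ-isGroupHomomorphism S-linear)
    (IsModuleHomomorphism.+ᴹ-isGroupHomomorphism T-linear)
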